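{- Let $T$ be an observational commutative monad on a cartesian monoidal category $\mathbb C$. Then every deterministic morphism in $\mathsf{Kl}(T)$ is thunkable.
   Context: Kleisli morphisms $f:A\rightsquigarrow B$ correspond to $f^\sharp:A\to TB$, composition $(g\circledcirc f)^\sharp=\mu\circ Tg^\sharp\circ f^\sharp$. Commutativity gives a symmetric monoidal structure $\nabla_{A,B}:TA\times TB\to T(A\times B)$, and $\mathsf{Kl}(T)$ is symmetric monoidal with $A\otimes B=A\times B$, $(f\otimes g)^\sharp=\nabla\circ(f^\sharp\times g^\sharp)$; copy-discard structure $(\mathsf{copy}_X)^\sharp=\eta\circ\Delta_X$, $(\mathsf{del}_X)^\sharp=\eta_1\circ!_X$. $f:X\rightsquigarrow Y$ is deterministic if $\mathsf{copy}_Y\circledcirc f=(f\otimes f)\circledcirc\mathsf{copy}_X$ and $\mathsf{del}_Y\circledcirc f=\mathsf{del}_X$. Thunk-force structure: $LA=TA$, $(Lf)^\sharp=\eta_{TB}\circ\mu_B\circ Tf^\sharp$, $(\mathsf{thunk}_A)^\sharp=\eta_{TA}\circ\eta_A$, $(\mathsf{force}_A)^\sharp=1_{TA}$; $f:A\rightsquigarrow B$ is thunkable if $\mathsf{thunk}_B\circledcirc f=Lf\circledcirc\mathsf{thunk}_A$. $\mathsf{copy}_n:Y\rightsquigarrow Y^{\otimes n}$ is the iterated copy ($\mathsf{copy}_0=\mathsf{del}$, $\mathsf{copy}_1=1$), and $\mathsf{samp}_n=\mathsf{force}^{\otimes n}\circledcirc\mathsf{copy}_n:TX\rightsquigarrow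 X^{\otimes n}$. $T$ is observational if for every object $X$ the family $(\mathsf{samp}_n)_{n\in\mathbb N}$ is jointly monic in $\mathsf{Kl}(T)$ (i.e. $\mathsf{samp}_n\circledcirc a=\mathsf{samp}_n\circledcirc b$ for all $n$ implies $a=b$). -}

module Defs where

open import Level using (Level; _⊔_)
open import Data.Nat using (ℕ; zero; suc)
open import Relation.Binary.PropositionalEquality using (_≡_)

record Category (o ℓ : Level) : Set (Level.suc (o ⊔ ℓ)) where
  infixr 9 _∘_
  field
    Obj  : Set o
    Hom  : Obj → Obj → Set ℓ
    id   : ∀ {A} → Hom A A
    _∘_  : ∀ {A B C} → Hom B C → Hom A B → Hom A C
    identityˡ : ∀ {A B} {f : Hom A B} → id ∘ f ≡ f
    identityʳ : ∀ {A B} {f : Hom A B} → f ∘ id ≡ f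
    assoc     : ∀ {A B C D} {f : Hom A B} {g : Hom B C} {h : Hom C D} →
                (h ∘ g) ∘ f ≡ h ∘ (g ∘ f)

record Cartesian {o ℓ} (𝒞 : Category o ℓ) : Set (o ⊔ ℓ) where
  open Category 𝒞
  infixr 7 _×_
  field
    ⊤     : Obj
    !     : ∀ {A} → Hom A ⊤
    !-unique : ∀ {A} (f : Hom A ⊤) → f ≡ !
    _×_   : Obj → Obj → Obj
    π₁    : ∀ {A B} → Hom (A × B) A
    π₂    : ∀ {A B} → Hom (A × B) B
    ⟨_,_⟩ : ∀ {X A B} → Hom X A → Hom X B → Hom X (A × B)
    project₁ : ∀ {X A B} {f : Hom X A} {g : Hom X B} → π₁ ∘ ⟨ f , g ⟩ ≡ f
    project₂ : ∀ {X A B} {f : Hom X A} {g : Hom X B} → π₂ ∘ ⟨ f , g ⟩ ≡ g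
    unique   : ∀ {X A B} {h : Hom X (A × B)} {f : Hom X A} {g : Hom X B} →
               π₁ ∘ h ≡ f → π₂ ∘ h ≡ g → ⟨ f , g ⟩ ≡ h

  infixr 8 _⁂_
  _⁂_ : ∀ {A B C D} → Hom A B → Hom C D → Hom (A × C) (B × D)
  f ⁂ g = ⟨ f ∘ π₁ , g ∘ π₂ ⟩

  Δ : ∀ {A} → Hom A (A × A)
  Δ = ⟨ id , id ⟩

  swap : ∀ {A B} → Hom (A × B) (B × A)
  swap = ⟨ π₂ , π₁ ⟩

  α⇒ : ∀ {A B C} → Hom ((A × B) × C) (A × (B × C))
  α⇒ = ⟨ π₁ ∘ π₁ , ⟨ π₂ ∘ π₁ , π₂ ⟩ ⟩

record CartesianCategory (o ℓ : Level) : Set (Level.suc (o ⊔ ℓ)) where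
  field
    category  : Category o ℓ
    cartesian : Cartesian category
  open Category category public
  open Cartesian cartesian public

record CommutativeMonad {o ℓ} (𝒞 : CartesianCategory o ℓ) : Set (o ⊔ ℓ) where
  open CartesianCategory 𝒞
  field
    T₀ : Obj → Obj
    T₁ : ∀ {A B} → Hom A B → Hom (T₀ A) (T₀ B)
    T-identity : ∀ {A} → T₁ (id {A}) ≡ id
    T-homomorphism : ∀ {A B C} {f : Hom A B} {g : Hom B C} →
                     T₁ (g ∘ f) ≡ T₁ g ∘ T₁ f
    η : ∀ {A} → Hom A (T₀ A)
    μ : ∀ {A} → Hom (T₀ (T₀ A)) (T₀ A)
    η-natural : ∀ {A B} {f : Hom A B} → η ∘ f ≡ T₁ f ∘ η
    μ-natural : ∀ {A B} {f : Hom A B} → μ ∘ T₁ (T₁ f) ≡ T₁ f ∘ μ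
    μ-assoc     : ∀ {A} → μ {A} ∘ T₁ μ ≡ μ ∘ μ
    μ-identityˡ : ∀ {A} → μ {A} ∘ T₁ η ≡ id
    μ-identityʳ : ∀ {A} → μ {A} ∘ η ≡ id
    t : ∀ {A B} → Hom (A × T₀ B) (T₀ (A × B))
    t-natural : ∀ {A A' B B'} {f : Hom A A'} {g : Hom B B'} →
                t ∘ (f ⁂ T₁ g) ≡ T₁ (f ⁂ g) ∘ t
    t-unit    : ∀ {B} → T₁ π₂ ∘ t {⊤} {B} ≡ π₂
    t-assoc   : ∀ {A B C} →
                T₁ α⇒ ∘ t {A × B} {C} ≡ t ∘ (id ⁂ t) ∘ α⇒
    t-η       : ∀ {A B} → t ∘ (id ⁂ η) ≡ η {A × B}
    t-μ       : ∀ {A B} → t ∘ (id ⁂ μ) ≡ μ ∘ T₁ t ∘ t {A} {T₀ B}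

  t' : ∀ {A B} → Hom (T₀ A × B) (T₀ (A × B))
  t' = T₁ swap ∘ t ∘ swap

  φ : ∀ {A B} → Hom (T₀ A × T₀ B) (T₀ (A × B))
  φ = μ ∘ T₁ t' ∘ t

  ψ : ∀ {A B} → Hom (T₀ A × T₀ B) (T₀ (A × B))
  ψ = μ ∘ T₁ t ∘ t'

  field
    commutative : ∀ {A B} → φ {A} {B} ≡ ψ

  ∇ : ∀ {A B} → Hom (T₀ A × T₀ B) (T₀ (A × B))
  ∇ = φ

module Kleisli {o ℓ} {𝒞 : CartesianCategory o ℓ} (M : CommutativeMonad 𝒞) where
  open CartesianCategory 𝒞
  open CommutativeMonad M

  _⇝_ : Obj → Obj → Set ℓ
  A ⇝ B = Hom A (T₀ B)

  infixr 9 _⊚_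
  _⊚_ : ∀ {A B C} → B ⇝ C → A ⇝ B → A ⇝ C
  g ⊚ f = μ ∘ T₁ g ∘ f

  kid : ∀ {A} → A ⇝ A
  kid = η

  infixr 8 _⊗_
  _⊗_ : ∀ {A B C D} → A ⇝ B → C ⇝ D → (A × C) ⇝ (B × D)
  f ⊗ g = ∇ ∘ (f ⁂ g)

  copy : ∀ {X} → X ⇝ (X × X)
  copy = η ∘ Δ

  del : ∀ {X} → X ⇝ ⊤
  del = η ∘ !

  Deterministic : ∀ {X Y} → X ⇝ Y → Set ℓ
  Deterministic {X} {Y} f =
    (copy ⊚ f ≡ (f ⊗ f) ⊚ copy) Data.Product.× (del ⊚ f ≡ del)
    where import Data.Product

  L : ∀ {A B} → A ⇝ B → T₀ A ⇝ T₀ B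
  L f = η ∘ μ ∘ T₁ f

  thunk : ∀ {A} → A ⇝ T₀ A
  thunk = η ∘ η

  force : ∀ {A} → T₀ A ⇝ A
  force = id

  Thunkable : ∀ {A B} → A ⇝ B → Set ℓ
  Thunkable f = thunk ⊚ f ≡ L f ⊚ thunk

  _^⊗_ : Obj → ℕ → Obj
  Y ^⊗ zero = ⊤
  Y ^⊗ suc zero = Y
  Y ^⊗ suc (suc n) = Y × (Y ^⊗ suc n)

  copyₙ : ∀ {Y} (n : ℕ) → Y ⇝ (Y ^⊗ n)
  copyₙ zero = del
  copyₙ (suc zero) = kid
  copyₙ (suc (suc n)) = (kid ⊗ copyₙ (suc n)) ⊚ copy

  _⊗^_ : ∀ {A B} → A ⇝ B → (n : ℕ) → (A ^⊗ n) ⇝ (B ^⊗ n)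
  f ⊗^ zero = kid
  f ⊗^ suc zero = f
  f ⊗^ suc (suc n) = f ⊗ (f ⊗^ suc n)

  samp : ∀ {X} (n : ℕ) → T₀ X ⇝ (X ^⊗ n)
  samp n = (force ⊗^ n) ⊚ copyₙ n

  Observational : Set (o ⊔ ℓ)
  Observational = ∀ {X A} (a b : A ⇝ T₀ X) →
                  (∀ n → samp n ⊚ a ≡ samp n ⊚ b) → a ≡ b

-- Thunkability of f says T η ∘ f ≡ η ∘ f, an equation between Kleisli maps
-- A ⇝ T B, so by observationality it suffices to compare their composites with
-- every samp n.  Postcomposing samp n with η ∘ f just samples f n times
-- independently, giving f ⊗^ n ∘ Δ^ n, whereas postcomposing it with T η ∘ f
-- copies a single outcome of f, giving T(Δ^ n) ∘ f.  Determinism (copy and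
-- discard commute with f) says exactly that these agree, by induction on n.
module Submission where

open import Defs
open import Level using (Level)
open import Data.Nat using (zero; suc)
open import Data.Product using (proj₁; proj₂)
open import Relation.Binary.PropositionalEquality

module CartesianProperties {o ℓ} (𝒞 : CartesianCategory o ℓ) where
  open CartesianCategory 𝒞

  private variable
    A B C D E F X : Obj

  ⟨⟩∘ : {f : Hom B C} {g : Hom B D} {h : Hom A B} → ⟨ f , g ⟩ ∘ h ≡ ⟨ f ∘ h , g ∘ h ⟩
  ⟨⟩∘ {f = f} {g} {h} = sym (unique (trans (sym assoc) (cong (_∘ h) project₁))
                                    (trans (sym assoc) (cong (_∘ h) project₂)))

  ⁂∘⟨⟩ : {f : Hom B C} {g : Hom D E} {h : Hom A B} {k : Hom A D} →
         (f ⁂ g) ∘ ⟨ h , k ⟩ ≡ ⟨ f ∘ h , g ∘ k ⟩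
  ⁂∘⟨⟩ {f = f} {g} = trans ⟨⟩∘ (cong₂ ⟨_,_⟩ (trans assoc (cong (f ∘_) project₁))
                                             (trans assoc (cong (g ∘_) project₂)))

  ⁂∘⁂ : {f : Hom B C} {g : Hom E F} {h : Hom A B} {k : Hom D E} →
        (f ⁂ g) ∘ (h ⁂ k) ≡ (f ∘ h) ⁂ (g ∘ k)
  ⁂∘⁂ = trans ⁂∘⟨⟩ (cong₂ ⟨_,_⟩ (sym assoc) (sym assoc))

  ⁂∘Δ : {f : Hom A B} {g : Hom A C} → (f ⁂ g) ∘ Δ ≡ ⟨ f , g ⟩
  ⁂∘Δ = trans ⁂∘⟨⟩ (cong₂ ⟨_,_⟩ identityʳ identityʳ)

  swap∘⟨⟩ : {f : Hom X A} {g : Hom X B} → swap ∘ ⟨ f , g ⟩ ≡ ⟨ g , f ⟩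
  swap∘⟨⟩ = trans ⟨⟩∘ (cong₂ ⟨_,_⟩ project₂ project₁)

  swap∘⁂ : {f : Hom A B} {g : Hom C D} → swap ∘ (f ⁂ g) ≡ (g ⁂ f) ∘ swap
  swap∘⁂ = trans swap∘⟨⟩ (sym ⁂∘⟨⟩)

  swap∘swap : swap ∘ swap {A} {B} ≡ id
  swap∘swap = trans swap∘⟨⟩ (unique identityʳ identityʳ)

module KleisliProperties {o ℓ} {𝒞 : CartesianCategory o ℓ} (M : CommutativeMonad 𝒞) where
  open CartesianCategory 𝒞
  open CartesianProperties 𝒞
  open CommutativeMonad M
  open Kleisli M
  open ≡-Reasoning

  private variable
    A B C D X Y : Obj

  T₁id∘ : {f : Hom A (T₀ B)} → T₁ id ∘ f ≡ f
  T₁id∘ = trans (cong (_∘ _) T-identity) identityˡ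

  ⊚η : {g : A ⇝ B} → g ⊚ η ≡ g
  ⊚η {g = g} = begin
    μ ∘ T₁ g ∘ η    ≡⟨ cong (μ ∘_) (sym η-natural) ⟩
    μ ∘ η ∘ g       ≡⟨ trans (sym assoc) (cong (_∘ g) μ-identityʳ) ⟩
    id ∘ g          ≡⟨ identityˡ ⟩
    g               ∎

  ⊚η∘ : {g : B ⇝ C} {h : Hom A B} → g ⊚ (η ∘ h) ≡ g ∘ h
  ⊚η∘ {g = g} {h} = begin
    μ ∘ T₁ g ∘ η ∘ h     ≡⟨ trans (cong (μ ∘_) (sym assoc)) (sym assoc) ⟩
    (μ ∘ T₁ g ∘ η) ∘ h   ≡⟨ cong (_∘ h) ⊚η ⟩
    g ∘ h                ∎

  η∘⊚ : {h : Hom B C} {f : A ⇝ B} → (η ∘ h) ⊚ f ≡ T₁ h ∘ f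
  η∘⊚ {h = h} {f} = begin
    μ ∘ T₁ (η ∘ h) ∘ f      ≡⟨ cong (λ z → μ ∘ z ∘ f) T-homomorphism ⟩
    μ ∘ (T₁ η ∘ T₁ h) ∘ f   ≡⟨ trans (cong (μ ∘_) assoc) (sym assoc) ⟩
    (μ ∘ T₁ η) ∘ T₁ h ∘ f   ≡⟨ trans (cong (_∘ (T₁ h ∘ f)) μ-identityˡ) identityˡ ⟩
    T₁ h ∘ f                ∎

  thunk⊚ : {f : A ⇝ B} → thunk ⊚ f ≡ T₁ η ∘ f
  thunk⊚ = η∘⊚

  L⊚thunk : {f : A ⇝ B} → L f ⊚ thunk ≡ η ∘ f
  L⊚thunk {f = f} = begin
    L f ⊚ (η ∘ η)          ≡⟨ ⊚η∘ ⟩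
    (η ∘ μ ∘ T₁ f) ∘ η     ≡⟨ trans assoc (cong (η ∘_) assoc) ⟩
    η ∘ μ ∘ T₁ f ∘ η       ≡⟨ cong (η ∘_) ⊚η ⟩
    η ∘ f                  ∎

  T₁η∘≡η∘⇒Thunkable : {f : A ⇝ B} → T₁ η ∘ f ≡ η ∘ f → Thunkable f
  T₁η∘≡η∘⇒Thunkable eq = trans thunk⊚ (trans eq (sym L⊚thunk))

  t'-natural : {g : Hom A B} {h : Hom C D} → T₁ (g ⁂ h) ∘ t' ≡ t' ∘ (T₁ g ⁂ h)
  t'-natural {g = g} {h} = begin
    T₁ (g ⁂ h) ∘ T₁ swap ∘ t ∘ swap       ≡⟨ sym assoc ⟩
    (T₁ (g ⁂ h) ∘ T₁ swap) ∘ t ∘ swap     ≡⟨ cong (_∘ (t ∘ swap)) (sym T-homomorphism) ⟩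
    T₁ ((g ⁂ h) ∘ swap) ∘ t ∘ swap        ≡⟨ cong (λ z → T₁ z ∘ t ∘ swap) (sym swap∘⁂) ⟩
    T₁ (swap ∘ (h ⁂ g)) ∘ t ∘ swap        ≡⟨ cong (_∘ (t ∘ swap)) T-homomorphism ⟩
    (T₁ swap ∘ T₁ (h ⁂ g)) ∘ t ∘ swap     ≡⟨ trans assoc (cong (T₁ swap ∘_) (sym assoc)) ⟩
    T₁ swap ∘ (T₁ (h ⁂ g) ∘ t) ∘ swap     ≡⟨ cong (λ z → T₁ swap ∘ z ∘ swap) (sym t-natural) ⟩
    T₁ swap ∘ (t ∘ (h ⁂ T₁ g)) ∘ swap     ≡⟨ cong (T₁ swap ∘_) assoc ⟩
    T₁ swap ∘ t ∘ (h ⁂ T₁ g) ∘ swap       ≡⟨ cong (λ z → T₁ swap ∘ t ∘ z) (sym swap∘⁂) ⟩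
    T₁ swap ∘ t ∘ swap ∘ (T₁ g ⁂ h)       ≡⟨ trans (cong (T₁ swap ∘_) (sym assoc)) (sym assoc) ⟩
    (T₁ swap ∘ t ∘ swap) ∘ (T₁ g ⁂ h)     ∎

  t'-η : t' ∘ (η ⁂ id) ≡ η {A × B}
  t'-η = begin
    (T₁ swap ∘ t ∘ swap) ∘ (η ⁂ id)  ≡⟨ trans assoc (cong (T₁ swap ∘_) assoc) ⟩
    T₁ swap ∘ t ∘ swap ∘ (η ⁂ id)    ≡⟨ cong (λ z → T₁ swap ∘ t ∘ z) swap∘⁂ ⟩
    T₁ swap ∘ t ∘ (id ⁂ η) ∘ swap    ≡⟨ cong (T₁ swap ∘_) (sym assoc) ⟩
    T₁ swap ∘ (t ∘ (id ⁂ η)) ∘ swap  ≡⟨ cong (λ z → T₁ swap ∘ z ∘ swap) t-η ⟩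
    T₁ swap ∘ η ∘ swap               ≡⟨ sym assoc ⟩
    (T₁ swap ∘ η) ∘ swap             ≡⟨ cong (_∘ swap) (sym η-natural) ⟩
    (η ∘ swap) ∘ swap                ≡⟨ trans assoc (cong (η ∘_) swap∘swap) ⟩
    η ∘ id                           ≡⟨ identityʳ ⟩
    η                                ∎

  ∇-natural : {g : Hom A B} {h : Hom C D} → T₁ (g ⁂ h) ∘ ∇ ≡ ∇ ∘ (T₁ g ⁂ T₁ h)
  ∇-natural {g = g} {h} = begin
    T₁ (g ⁂ h) ∘ μ ∘ T₁ t' ∘ t          ≡⟨ sym assoc ⟩
    (T₁ (g ⁂ h) ∘ μ) ∘ T₁ t' ∘ t        ≡⟨ cong (_∘ (T₁ t' ∘ t)) (sym μ-natural) ⟩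
    (μ ∘ T₁ (T₁ (g ⁂ h))) ∘ T₁ t' ∘ t   ≡⟨ trans assoc (cong (μ ∘_) (sym assoc)) ⟩
    μ ∘ (T₁ (T₁ (g ⁂ h)) ∘ T₁ t') ∘ t   ≡⟨ cong (λ z → μ ∘ z ∘ t) (sym T-homomorphism) ⟩
    μ ∘ T₁ (T₁ (g ⁂ h) ∘ t') ∘ t        ≡⟨ cong (λ z → μ ∘ T₁ z ∘ t) t'-natural ⟩
    μ ∘ T₁ (t' ∘ (T₁ g ⁂ h)) ∘ t        ≡⟨ cong (λ z → μ ∘ z ∘ t) T-homomorphism ⟩
    μ ∘ (T₁ t' ∘ T₁ (T₁ g ⁂ h)) ∘ t     ≡⟨ cong (μ ∘_) assoc ⟩
    μ ∘ T₁ t' ∘ T₁ (T₁ g ⁂ h) ∘ t       ≡⟨ cong (λ z → μ ∘ T₁ t' ∘ z) (sym t-natural) ⟩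
    μ ∘ T₁ t' ∘ t ∘ (T₁ g ⁂ T₁ h)       ≡⟨ trans (cong (μ ∘_) (sym assoc)) (sym assoc) ⟩
    (μ ∘ T₁ t' ∘ t) ∘ (T₁ g ⁂ T₁ h)     ∎

  ∇-η : ∇ ∘ (η ⁂ η) ≡ η {A × B}
  ∇-η = begin
    (μ ∘ T₁ t' ∘ t) ∘ (η ⁂ η)                ≡⟨ cong ((μ ∘ T₁ t' ∘ t) ∘_) η⁂η≡ ⟩
    (μ ∘ T₁ t' ∘ t) ∘ (id ⁂ η) ∘ (η ⁂ id)    ≡⟨ trans assoc (cong (μ ∘_) assoc) ⟩
    μ ∘ T₁ t' ∘ t ∘ (id ⁂ η) ∘ (η ⁂ id)      ≡⟨ cong (λ z → μ ∘ T₁ t' ∘ z) (sym assoc) ⟩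
    μ ∘ T₁ t' ∘ (t ∘ (id ⁂ η)) ∘ (η ⁂ id)    ≡⟨ cong (λ z → μ ∘ T₁ t' ∘ z ∘ (η ⁂ id)) t-η ⟩
    t' ⊚ (η ∘ (η ⁂ id))                      ≡⟨ ⊚η∘ ⟩
    t' ∘ (η ⁂ id)                            ≡⟨ t'-η ⟩
    η                                        ∎
    where
    η⁂η≡ : η ⁂ η ≡ (id ⁂ η) ∘ (η ⁂ id)
    η⁂η≡ = sym (trans ⁂∘⁂ (cong₂ _⁂_ identityˡ identityʳ))

  ⊗∘⁂ : {f : B ⇝ C} {f' : Y ⇝ D} {g : Hom A B} {h : Hom X Y} →
        (f ⊗ f') ∘ (g ⁂ h) ≡ (f ∘ g) ⊗ (f' ∘ h)
  ⊗∘⁂ = trans assoc (cong (∇ ∘_) ⁂∘⁂)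

  T₁⁂∘⊗ : {f : A ⇝ B} {f' : X ⇝ Y} {g : Hom B C} {h : Hom Y D} →
          T₁ (g ⁂ h) ∘ (f ⊗ f') ≡ (T₁ g ∘ f) ⊗ (T₁ h ∘ f')
  T₁⁂∘⊗ {f = f} {f'} = trans (sym assoc) (trans (cong (_∘ (f ⁂ f')) ∇-natural) ⊗∘⁂)

  Δ^ : ∀ n → Hom X (X ^⊗ n)
  Δ^ zero = !
  Δ^ (suc zero) = id
  Δ^ (suc (suc n)) = ⟨ id , Δ^ (suc n) ⟩

  infix 10 _⁂^_
  _⁂^_ : Hom X Y → ∀ n → Hom (X ^⊗ n) (Y ^⊗ n)
  g ⁂^ zero = id
  g ⁂^ suc zero = g
  g ⁂^ suc (suc n) = g ⁂ g ⁂^ suc n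

  Δ^-natural : ∀ n (g : Hom X Y) → Δ^ n ∘ g ≡ (g ⁂^ n) ∘ Δ^ n
  Δ^-natural zero g = trans (!-unique _) (sym identityˡ)
  Δ^-natural (suc zero) g = trans identityˡ (sym identityʳ)
  Δ^-natural (suc (suc n)) g = begin
    ⟨ id , Δ^ (suc n) ⟩ ∘ g                ≡⟨ ⟨⟩∘ ⟩
    ⟨ id ∘ g , Δ^ (suc n) ∘ g ⟩            ≡⟨ cong₂ ⟨_,_⟩ (trans identityˡ (sym identityʳ))
                                                          (Δ^-natural (suc n) g) ⟩
    ⟨ g ∘ id , (g ⁂^ suc n) ∘ Δ^ (suc n) ⟩ ≡⟨ sym ⁂∘⟨⟩ ⟩
    (g ⁂ g ⁂^ suc n) ∘ ⟨ id , Δ^ (suc n) ⟩ ∎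

  force⊗^∘⁂^ : ∀ n (g : X ⇝ Y) → (force ⊗^ n) ∘ (g ⁂^ n) ≡ g ⊗^ n
  force⊗^∘⁂^ zero g = identityʳ
  force⊗^∘⁂^ (suc zero) g = identityˡ
  force⊗^∘⁂^ (suc (suc n)) g = trans ⊗∘⁂ (cong₂ _⊗_ identityˡ (force⊗^∘⁂^ (suc n) g))

  η⊗^ : ∀ n → η ⊗^ n ≡ η {X ^⊗ n}
  η⊗^ zero = refl
  η⊗^ (suc zero) = refl
  η⊗^ (suc (suc n)) = trans (cong (η ⊗_) (η⊗^ (suc n))) ∇-η

  copyₙ≡η∘Δ^ : ∀ n → copyₙ {X} n ≡ η ∘ Δ^ n
  copyₙ≡η∘Δ^ zero = refl
  copyₙ≡η∘Δ^ (suc zero) = sym identityʳ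
  copyₙ≡η∘Δ^ (suc (suc n)) = begin
    (kid ⊗ copyₙ (suc n)) ⊚ (η ∘ Δ)        ≡⟨ ⊚η∘ ⟩
    (η ⊗ copyₙ (suc n)) ∘ Δ                ≡⟨ cong (λ z → (η ⊗ z) ∘ Δ) (copyₙ≡η∘Δ^ (suc n)) ⟩
    (η ⊗ (η ∘ Δ^ (suc n))) ∘ Δ             ≡⟨ trans assoc (cong (∇ ∘_) ⁂∘Δ) ⟩
    ∇ ∘ ⟨ η , η ∘ Δ^ (suc n) ⟩             ≡⟨ cong (λ z → ∇ ∘ ⟨ z , η ∘ Δ^ (suc n) ⟩) (sym identityʳ) ⟩
    ∇ ∘ ⟨ η ∘ id , η ∘ Δ^ (suc n) ⟩        ≡⟨ cong (∇ ∘_) (sym ⁂∘⟨⟩) ⟩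
    ∇ ∘ (η ⁂ η) ∘ ⟨ id , Δ^ (suc n) ⟩      ≡⟨ trans (sym assoc) (cong (_∘ ⟨ id , Δ^ (suc n) ⟩) ∇-η) ⟩
    η ∘ ⟨ id , Δ^ (suc n) ⟩                ∎

  samp≡force⊗^∘Δ^ : ∀ n → samp {X} n ≡ (force ⊗^ n) ∘ Δ^ n
  samp≡force⊗^∘Δ^ n = trans (cong ((force ⊗^ n) ⊚_) (copyₙ≡η∘Δ^ n)) ⊚η∘

  samp∘η : ∀ n → samp {X} n ∘ η ≡ η ∘ Δ^ n
  samp∘η n = begin
    samp n ∘ η                       ≡⟨ cong (_∘ η) (samp≡force⊗^∘Δ^ n) ⟩
    ((force ⊗^ n) ∘ Δ^ n) ∘ η        ≡⟨ trans assoc (cong ((force ⊗^ n) ∘_) (Δ^-natural n η)) ⟩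
    (force ⊗^ n) ∘ (η ⁂^ n) ∘ Δ^ n   ≡⟨ sym assoc ⟩
    ((force ⊗^ n) ∘ (η ⁂^ n)) ∘ Δ^ n ≡⟨ cong (_∘ Δ^ n) (trans (force⊗^∘⁂^ n η) (η⊗^ n)) ⟩
    η ∘ Δ^ n                         ∎

  samp⊚T₁η∘ : ∀ n {f : A ⇝ B} → samp n ⊚ (T₁ η ∘ f) ≡ T₁ (Δ^ n) ∘ f
  samp⊚T₁η∘ n {f} = begin
    μ ∘ T₁ (samp n) ∘ T₁ η ∘ f   ≡⟨ cong (μ ∘_) (sym assoc) ⟩
    μ ∘ (T₁ (samp n) ∘ T₁ η) ∘ f ≡⟨ cong (λ z → μ ∘ z ∘ f) (sym T-homomorphism) ⟩
    (samp n ∘ η) ⊚ f             ≡⟨ cong (_⊚ f) (samp∘η n) ⟩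
    (η ∘ Δ^ n) ⊚ f               ≡⟨ η∘⊚ ⟩
    T₁ (Δ^ n) ∘ f                ∎

  samp⊚η∘ : ∀ n {f : A ⇝ B} → samp n ⊚ (η ∘ f) ≡ (f ⊗^ n) ∘ Δ^ n
  samp⊚η∘ n {f} = begin
    samp n ⊚ (η ∘ f)                 ≡⟨ ⊚η∘ ⟩
    samp n ∘ f                       ≡⟨ cong (_∘ f) (samp≡force⊗^∘Δ^ n) ⟩
    ((force ⊗^ n) ∘ Δ^ n) ∘ f        ≡⟨ trans assoc (cong ((force ⊗^ n) ∘_) (Δ^-natural n f)) ⟩
    (force ⊗^ n) ∘ (f ⁂^ n) ∘ Δ^ n   ≡⟨ trans (sym assoc) (cong (_∘ Δ^ n) (force⊗^∘⁂^ n f)) ⟩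
    (f ⊗^ n) ∘ Δ^ n                  ∎

  module _ {f : A ⇝ B} (det : Deterministic f) where
    T₁Δ∘deterministic : T₁ Δ ∘ f ≡ (f ⊗ f) ∘ Δ
    T₁Δ∘deterministic = trans (sym η∘⊚) (trans (proj₁ det) ⊚η∘)

    T₁!∘deterministic : T₁ ! ∘ f ≡ η ∘ !
    T₁!∘deterministic = trans (sym η∘⊚) (proj₂ det)

    T₁Δ^∘deterministic : ∀ n → T₁ (Δ^ n) ∘ f ≡ (f ⊗^ n) ∘ Δ^ n
    T₁Δ^∘deterministic zero = T₁!∘deterministic
    T₁Δ^∘deterministic (suc zero) = trans T₁id∘ (sym identityʳ)
    T₁Δ^∘deterministic (suc (suc n)) = begin
      T₁ ⟨ id , Δ^ (suc n) ⟩ ∘ f                        ≡⟨ cong (λ z → T₁ z ∘ f) (sym ⁂∘Δ) ⟩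
      T₁ ((id ⁂ Δ^ (suc n)) ∘ Δ) ∘ f                    ≡⟨ trans (cong (_∘ f) T-homomorphism) assoc ⟩
      T₁ (id ⁂ Δ^ (suc n)) ∘ T₁ Δ ∘ f                   ≡⟨ cong (T₁ (id ⁂ Δ^ (suc n)) ∘_) T₁Δ∘deterministic ⟩
      T₁ (id ⁂ Δ^ (suc n)) ∘ (f ⊗ f) ∘ Δ                ≡⟨ trans (sym assoc) (cong (_∘ Δ) T₁⁂∘⊗) ⟩
      ((T₁ id ∘ f) ⊗ (T₁ (Δ^ (suc n)) ∘ f)) ∘ Δ         ≡⟨ cong (_∘ Δ) (cong₂ _⊗_ (trans T₁id∘ (sym identityʳ))
                                                                               (T₁Δ^∘deterministic (suc n))) ⟩
      ((f ∘ id) ⊗ ((f ⊗^ suc n) ∘ Δ^ (suc n))) ∘ Δ      ≡⟨ cong (_∘ Δ) (sym ⊗∘⁂) ⟩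
      ((f ⊗ (f ⊗^ suc n)) ∘ (id ⁂ Δ^ (suc n))) ∘ Δ      ≡⟨ trans assoc (cong ((f ⊗ (f ⊗^ suc n)) ∘_) ⁂∘Δ) ⟩
      (f ⊗ (f ⊗^ suc n)) ∘ ⟨ id , Δ^ (suc n) ⟩          ∎

theorem7p1 : ∀ {o ℓ : Level} (𝒞 : CartesianCategory o ℓ) (M : CommutativeMonad 𝒞) →
    Kleisli.Observational M →
    ∀ {A B} (f : Kleisli._⇝_ M A B) → Kleisli.Deterministic M f → Kleisli.Thunkable M f
theorem7p1 𝒞 M observational f det = T₁η∘≡η∘⇒Thunkable (observational _ _ samp-agree)
  where
  open CartesianCategory 𝒞
  open CommutativeMonad M
  open Kleisli M
  open KleisliProperties M
  open ≡-Reasoning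

  samp-agree : ∀ n → samp n ⊚ (T₁ η ∘ f) ≡ samp n ⊚ (η ∘ f)
  samp-agree n = begin
    samp n ⊚ (T₁ η ∘ f)  ≡⟨ samp⊚T₁η∘ n ⟩
    T₁ (Δ^ n) ∘ f        ≡⟨ T₁Δ^∘deterministic det n ⟩
    (f ⊗^ n) ∘ Δ^ n      ≡⟨ sym (samp⊚η∘ n) ⟩
    samp n ⊚ (η ∘ f)     ∎
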